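{- Let $\hat\tau$ be a constructor translation from a logic $\mathcal{L}''$ to a logic $\mathcal{L}'$ and $\mathrm{G}_{\mathcal{L}'}$ a Gentzen calculus for $\mathcal{L}'$. If the axioms of $\mathrm{G}_{\mathcal{L}'}$ are sound in $\mathcal{L}'$, then the axioms of $\mathrm{G}_{\mathcal{L}''\sqcup\mathcal{L}'}$ are sound in $\mathcal{L}''\sqcup\mathcal{L}'$.
   Context: Each logic $\mathcal{L}$ has a signature $(C_{\mathcal{L},n})_{n\in\mathbb{N}}$, a denumerable set $P_{\mathcal{L}}$ of propositional symbols, formulas $F_{\mathcal{L}}$, a class $\mathcal{M}_{\mathcal{L}}$ of models and satisfaction $\Vdash_{\mathcal{L}}\subseteq\mathcal{M}_{\mathcal{L}}\times F_{\mathcal{L}}$. $M\Vdash_{\mathcal{L}}\Psi$ for a multiset $\Psi$ means $M\Vdash_{\mathcal{L}}\psi$ for all $\psi\in\Psi$; $M$ satisfies a sequent $\Psi\to\Lambda$ if $M\Vdash_{\mathcal{L}}\Psi$ implies $M\Vdash_{\mathcal{L}}\lambda$ for some $\lambda\in\Lambda$; a sequent is valid if every model satisfies it. An axiom is sound if all its instances are valid; a rule is sound if every model satisfying all premises of an instance satisfies its conclusion. $\mathcal{A}_{\mathcal{L}}$ is the collection of maps generated from $c^\bullet(\varphi_1,\dots,\varphi_n)=c(\varphi_1,\dots,\varphi_n)$ (0-ary constructors and propositional symbols as 0-argument maps) by composition, aggregation and projections. A constructor translation is an injective $\hat\tau:C_{\mathcal{L}''}\cup P_{\mathcal{L}''}\to\mathcal{A}_{\mathcal{L}'}$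 sending $n$-ary constructors to $n$-argument maps, propositional symbols to 0-argument maps, 0-ary constructors to $c'^\bullet$ with $c'\in C_{\mathcal{L}',0}$, and such that for all $p'',q''\in P_{\mathcal{L}''}$ there are $p',q'\in P_{\mathcal{L}'}$ with $p'$ occurring in $\hat\tau(p'')$ and $\hat\tau(q'')$ obtained from $\hat\tau(p'')$ replacing $p'$ by $q'$. $\tau$-identified symbols ($\hat\tau(c'')=c'^\bullet$) share the same name and are exactly the shared symbols. The combination $\mathcal{L}''\sqcup\mathcal{L}'$ has propositional symbols $P_{\mathcal{L}'}$, constructors $C_0=C_{\mathcal{L}'',0}\cup C_{\mathcal{L}',0}\cup(P_{\mathcal{L}''}\setminus P_{\mathcal{L}'})$, $C_n=C_{\mathcal{L}'',n}\cup C_{\mathcal{L}',n}$, models $\mathcal{M}_{\mathcal{L}'}$, and satisfaction $M'\Vdash_{\mathcal{L}''\sqcup\mathcal{L}'}\varphi$ iff $M'\Vdash_{\mathcal{L}'}\tau_\sqcup(\varphi)$, where $\tau_\sqcup$: $\tau_\sqcup(c'')=\hat\tau(c'')$ for $c''\in C_{\mathcal{L}'',0}\cup P_{\mathcal{L}''}$; $\tau_\sqcup(c')=c'$ for $c'\in C_{\mathcal{L}',0}\cup P_{\mathcal{L}'}$; $\tau_\sqcup(c''(\varphi_1,\dots,\varphi_n))=\hat\tau(c'')(\tau_\sqcup(\varphi_1),\dots,\tau_\sqcup(\varphi_n))$; $\tau_\sqcup(c'(\varphi_1,\dots,\varphi_n))=c'(\tau_\sqcup(\varphi_1),\dots,\tau_\sqcup(\varphi_n))$.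 Gentzen calculi: a sequent is $\Gamma\to\Delta$ with finite multisets. Axioms are premise-free rules of forms $p,\Gamma\to\Delta,p$; $c_1(p),\Gamma\to\Delta,c_1(p)$; $\Gamma\to\Delta,p,c_1(p)$; $\bot,\Gamma\to\Delta$ ($p$ a propositional symbol, $c_1$ unary, $\bot$ 0-ary). Left/right rules for $c$ (or pairs $c_1c$) have principal formula $c(\beta_1,\dots,\beta_n)$ (or $c_1(c(\beta_1,\dots,\beta_n))$) in the conclusion's antecedent/succedent. A Gentzen calculus is a finite set of axioms and of left/right rules, with the second axiom form present iff the third is. Instances replace metavariables $\Gamma,\Delta,\beta_i$ by formulas; propositional symbols and constructors are fixed. $\mathrm{G}_{\mathcal{L}''\sqcup\mathcal{L}'}$ consists of the axioms and rules of $\mathrm{G}_{\mathcal{L}'}$ (instantiated with combined formulas) plus: for $p''\in P_{\mathcal{L}''}$ (when $P_{\mathcal{L}''}\neq P_{\mathcal{L}'}$), from $\hat\tau(p''),\Gamma\to\Delta$ infer $p'',\Gamma\to\Delta$ and from $\Gamma\to\Delta,\hat\tau(p'')$ infer $\Gamma\to\Delta,p''$; for $c''\in C_{\mathcal{L}'',n}\setminus C_{\mathcal{L}',n}$, from $\hat\tau(c'')(\beta_1,\dots,\beta_n),\Gamma\to\Delta$ infer $c''(\beta_1,\dots,\beta_n),\Gamma\to\Delta$, and from $\Gamma\to\Delta,\hat\tau(c'')(\beta_1,\dots,\beta_n)$ infer $\Gamma\to\Delta,c''(\beta_1,\dots,\beta_n)$. -}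

module Defs where

open import Data.Nat using (ℕ; zero; suc)
import Data.Nat as Nat
open import Data.Fin using (Fin)
open import Data.Vec using (Vec; []; _∷_; lookup; tabulate)
open import Data.List using (List; []; _∷_)
import Data.List as List
open import Data.List.Membership.Propositional using (_∈_)
open import Data.List.Relation.Unary.All using (All)
open import Data.List.Relation.Unary.Any using (Any)
open import Data.Sum using (_⊎_; inj₁; inj₂)
open import Data.Product using (Σ; ∃; _×_; _,_; ∃-syntax)
open import Data.Empty using (⊥)
open import Relation.Nullary using (¬_; Dec; yes; no)
open import Relation.Binary.PropositionalEquality
open import Function.Bundles using (_↔_; Inverse)

data Form (C : ℕ → Set) (P : Set) : Set where
  var : P → Form C P
  app : ∀ {n} → C n → Vec (Form C P) n → Form C P

record Logic : Set₁ where
  field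
    Con         : ℕ → Set
    Prop        : Set
    denumerable : Prop ↔ ℕ
    Model       : Set
    _⊩_         : Model → Form Con Prop → Set

open Logic

Fm : Logic → Set
Fm L = Form (Con L) (Prop L)

-- Sequents (finite multisets represented by lists), satisfaction, validity.

record Sequent (C : ℕ → Set) (P : Set) : Set where
  constructor _⇒_
  field
    ante : List (Form C P)
    succ : List (Form C P)

Satisfies : (L : Logic) → Model L → Sequent (Con L) (Prop L) → Set
Satisfies L M (Γ ⇒ Δ) = All (λ φ → _⊩_ L M φ) Γ → Any (λ φ → _⊩_ L M φ) Δ

Valid : (L : Logic) → Sequent (Con L) (Prop L) → Set
Valid L s = ∀ M → Satisfies L M s

-- n-argument maps in A_L, represented syntactically: terms whose leaves are
-- propositional symbols (inj₁) or argument positions (inj₂).  Projections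
-- are variables, c^• is a constructor node, composition/aggregation are
-- substitution.  The same type serves as formula schemas with metavariables
-- β₁..βₙ (inj₂).

Term : (C : ℕ → Set) (P : Set) → ℕ → Set
Term C P n = Form C (P ⊎ Fin n)

args : ∀ {C P} n → Vec (Term C P n) n
args n = tabulate (λ i → var (inj₂ i))

bullet : ∀ {C P n} → C n → Term C P n
bullet {n = n} c = app c (args n)

mutual
  applyMap : ∀ {C P n} → Term C P n → Vec (Form C P) n → Form C P
  applyMap (var (inj₁ p)) φs = var p
  applyMap (var (inj₂ i)) φs = lookup φs i
  applyMap (app c ts) φs = app c (applyMaps ts φs)

  applyMaps : ∀ {C P n k} → Vec (Term C P n) k → Vec (Form C P) n → Vec (Form C P) k
  applyMaps [] φs = []
  applyMaps (t ∷ ts) φs = applyMap t φs ∷ applyMaps ts φs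

mutual
  Occurs : ∀ {C P n} → P → Term C P n → Set
  Occurs p (var (inj₁ q)) = p ≡ q
  Occurs p (var (inj₂ i)) = ⊥
  Occurs p (app c ts) = OccursV p ts

  OccursV : ∀ {C P n k} → P → Vec (Term C P n) k → Set
  OccursV p [] = ⊥
  OccursV p (t ∷ ts) = Occurs p t ⊎ OccursV p ts

decEqDen : ∀ {A : Set} → A ↔ ℕ → (x y : A) → Dec (x ≡ y)
decEqDen {A} e x y with Inverse.to e x Nat.≟ Inverse.to e y
... | yes eq = yes (trans (sym (Inverse.strictlyInverseʳ e x))
                     (trans (cong (Inverse.from e) eq) (Inverse.strictlyInverseʳ e y)))
... | no ne = no (λ eq → ne (cong (Inverse.to e) eq))

mutual
  replace : ∀ {C P n} → ((x y : P) → Dec (x ≡ y)) → P → P → Term C P n → Term C P n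
  replace d p q (var (inj₁ r)) with d r p
  ... | yes _ = var (inj₁ q)
  ... | no _  = var (inj₁ r)
  replace d p q (var (inj₂ i)) = var (inj₂ i)
  replace d p q (app c ts) = app c (replaceV d p q ts)

  replaceV : ∀ {C P n k} → ((x y : P) → Dec (x ≡ y)) → P → P →
             Vec (Term C P n) k → Vec (Term C P n) k
  replaceV d p q [] = []
  replaceV d p q (t ∷ ts) = replace d p q t ∷ replaceV d p q ts

record ConstructorTranslation (L'' L' : Logic) : Set where
  field
    τC : ∀ {n} → Con L'' n → Term (Con L') (Prop L') n
    τP : Prop L'' → Term (Con L') (Prop L') 0
    τC-inj  : ∀ {n} {c d : Con L'' n} → τC c ≡ τC d → c ≡ d
    τP-inj  : ∀ {p q : Prop L''} → τP p ≡ τP q → p ≡ q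
    τCP-inj : ∀ (c : Con L'' 0) (p : Prop L'') → τC c ≢ τP p
    τC-const : ∀ (c : Con L'' 0) → ∃[ c' ] τC c ≡ bullet c'
    τP-uniform : ∀ (p'' q'' : Prop L'') → ∃[ p' ] ∃[ q' ]
      (Occurs p' (τP p'') ×
       τP q'' ≡ replace (decEqDen (denumerable L')) p' q' (τP p''))

data Axiom (C : ℕ → Set) (P : Set) : Set where
  axP   : P → Axiom C P
  axC1L : C 1 → P → Axiom C P
  axC1R : C 1 → P → Axiom C P
  axBot : C 0 → Axiom C P

axInst : ∀ {C P} → Axiom C P → List (Form C P) → List (Form C P) → Sequent C P
axInst (axP p) Γ Δ = (var p ∷ Γ) ⇒ (var p ∷ Δ)
axInst (axC1L c p) Γ Δ = (app c (var p ∷ []) ∷ Γ) ⇒ (app c (var p ∷ []) ∷ Δ)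
axInst (axC1R c p) Γ Δ = Γ ⇒ (var p ∷ app c (var p ∷ []) ∷ Δ)
axInst (axBot b) Γ Δ = (app b [] ∷ Γ) ⇒ Δ

AxiomSound : (L : Logic) → Axiom (Con L) (Prop L) → Set
AxiomSound L ax = ∀ Γ Δ → Valid L (axInst ax Γ Δ)

AxiomsSound : (L : Logic) → List (Axiom (Con L) (Prop L)) → Set
AxiomsSound L axs = ∀ ax → ax ∈ axs → AxiomSound L ax

data Side : Set where
  left right : Side

data Principal (C : ℕ → Set) (n : ℕ) : Set where
  plain  : C n → Principal C n
  nested : C 1 → C n → Principal C n

principalForm : ∀ {C P n} → Principal C n → Term C P n
principalForm (plain c) = bullet c
principalForm (nested c₁ c) = app c₁ (bullet c ∷ [])

-- left/right rule schema; all sequents share the context metavariables Γ, Δ;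
-- a premise (A , S) stands for A, Γ → Δ, S.  Conclusion: principal formula
-- added on the given side.
record Rule (C : ℕ → Set) (P : Set) : Set where
  field
    arity     : ℕ
    side      : Side
    principal : Principal C arity
    premises  : List (List (Term C P arity) × List (Term C P arity))

record Gentzen (C : ℕ → Set) (P : Set) : Set where
  field
    axioms : List (Axiom C P)
    rules  : List (Rule C P)
    axC1-pair : ∀ c p → (axC1L c p ∈ axioms → axC1R c p ∈ axioms) ×
                        (axC1R c p ∈ axioms → axC1L c p ∈ axioms)

-- a (possibly infinite) calculus given by a list of axioms and a rule predicate
record GentzenSystem (C : ℕ → Set) (P : Set) : Set₁ where
  field
    axioms : List (Axiom C P)
    rules  : Rule C P → Set

module Combination {L'' L' : Logic} (T : ConstructorTranslation L'' L') where
  open ConstructorTranslation T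

  IdC : ∀ {n} → Con L'' n → Set
  IdC {n} c = ∃[ c' ] τC c ≡ bullet {P = Prop L'} {n = n} c'

  IdP : Prop L'' → Set
  IdP p = ∃[ p' ] τP p ≡ var (inj₁ p')

  Extra : ℕ → Set
  Extra zero = Σ (Prop L'') (λ p → ¬ IdP p)
  Extra (suc _) = ⊥

  -- C_n = C_{L'',n} ∪ C_{L',n} (shared = τ-identified symbols), plus
  -- P_{L''} \ P_{L'} in C_0
  CombC : ℕ → Set
  CombC n = Con L' n ⊎ (Σ (Con L'' n) (λ c → ¬ IdC c) ⊎ Extra n)

  mutual
    τ⊔ : Form CombC (Prop L') → Fm L'
    τ⊔ (var p) = var p
    τ⊔ (app (inj₁ c') φs) = app c' (τ⊔V φs)
    τ⊔ (app (inj₂ (inj₁ (c'' , _))) φs) = applyMap (τC c'') (τ⊔V φs)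
    τ⊔ (app {zero} (inj₂ (inj₂ (p'' , _))) φs) = applyMap (τP p'') []
    τ⊔ (app {suc n} (inj₂ (inj₂ ())) φs)

    τ⊔V : ∀ {k} → Vec (Form CombC (Prop L')) k → Vec (Fm L') k
    τ⊔V [] = []
    τ⊔V (φ ∷ φs) = τ⊔ φ ∷ τ⊔V φs

  combined : Logic
  combined = record
    { Con = CombC
    ; Prop = Prop L'
    ; denumerable = denumerable L'
    ; Model = Model L'
    ; _⊩_ = λ M φ → _⊩_ L' M (τ⊔ φ)
    }

  mutual
    embF : ∀ {X} → Form (Con L') X → Form CombC X
    embF (var x) = var x
    embF (app c φs) = app (inj₁ c) (embV φs)

    embV : ∀ {X k} → Vec (Form (Con L') X) k → Vec (Form CombC X) k
    embV [] = []
    embV (φ ∷ φs) = embF φ ∷ embV φs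

  embAx : Axiom (Con L') (Prop L') → Axiom CombC (Prop L')
  embAx (axP p) = axP p
  embAx (axC1L c p) = axC1L (inj₁ c) p
  embAx (axC1R c p) = axC1R (inj₁ c) p
  embAx (axBot b) = axBot (inj₁ b)

  embPr : ∀ {n} → Principal (Con L') n → Principal CombC n
  embPr (plain c) = plain (inj₁ c)
  embPr (nested c₁ c) = nested (inj₁ c₁) (inj₁ c)

  embRule : Rule (Con L') (Prop L') → Rule CombC (Prop L')
  embRule r = record
    { arity = Rule.arity r
    ; side = Rule.side r
    ; principal = embPr (Rule.principal r)
    ; premises = List.map (λ { (A , S) → List.map embF A , List.map embF S })
                          (Rule.premises r)
    }

  data NewRule : Rule CombC (Prop L') → Set where
    newPL : ∀ (p : Extra 0) → NewRule (record
      { arity = 0 ; side = left ; principal = plain (inj₂ (inj₂ p))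
      ; premises = ((embF (τP (Σ.proj₁ p)) ∷ []) , []) ∷ [] })
    newPR : ∀ (p : Extra 0) → NewRule (record
      { arity = 0 ; side = right ; principal = plain (inj₂ (inj₂ p))
      ; premises = ([] , (embF (τP (Σ.proj₁ p)) ∷ [])) ∷ [] })
    newCL : ∀ {n} (c : Σ (Con L'' n) (λ c → ¬ IdC c)) → NewRule (record
      { arity = n ; side = left ; principal = plain (inj₂ (inj₁ c))
      ; premises = ((embF (τC (Σ.proj₁ c)) ∷ []) , []) ∷ [] })
    newCR : ∀ {n} (c : Σ (Con L'' n) (λ c → ¬ IdC c)) → NewRule (record
      { arity = n ; side = right ; principal = plain (inj₂ (inj₁ c))
      ; premises = ([] , (embF (τC (Σ.proj₁ c)) ∷ [])) ∷ [] })

  G⊔ : Gentzen (Con L') (Prop L') → GentzenSystem CombC (Prop L')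
  G⊔ G = record
    { axioms = List.map embAx (Gentzen.axioms G)
    ; rules = λ r → (Any (λ r' → r ≡ embRule r') (Gentzen.rules G)) ⊎ NewRule r
    }

{-# OPTIONS --safe #-}
-- The axioms of G_{L''⊔L'} are those of G_{L'}, mentioning only symbols of
-- L', so τ⊔ maps each of their instances to an instance of the same
-- G_{L'}-axiom with translated contexts, which is valid by assumption.
module Submission where

open import Defs
open import Data.List using (map)
open import Data.List.Membership.Propositional.Properties using (∈-map⁻)
open import Data.List.Relation.Unary.All.Properties using (map⁺)
open import Data.List.Relation.Unary.Any.Properties using (map⁻)
open import Data.Product using (_,_)
open import Relation.Binary.PropositionalEquality using (_≡_; refl; sym; subst)

module _ {L'' L' : Logic} (T : ConstructorTranslation L'' L') where
  open Combination T

  translateSequent : Sequent CombC (Logic.Prop L') → Sequent (Logic.Con L') (Logic.Prop L')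
  translateSequent (Γ ⇒ Δ) = map τ⊔ Γ ⇒ map τ⊔ Δ

  satisfies-translateSequent⇒satisfies : ∀ M s →
    Satisfies L' M (translateSequent s) → Satisfies combined M s
  satisfies-translateSequent⇒satisfies M (Γ ⇒ Δ) sat ⊩Γ = map⁻ (sat (map⁺ ⊩Γ))

  translateSequent-embAx : ∀ ax Γ Δ →
    translateSequent (axInst (embAx ax) Γ Δ) ≡ axInst ax (map τ⊔ Γ) (map τ⊔ Δ)
  translateSequent-embAx (axP p)     Γ Δ = refl
  translateSequent-embAx (axC1L c p) Γ Δ = refl
  translateSequent-embAx (axC1R c p) Γ Δ = refl
  translateSequent-embAx (axBot b)   Γ Δ = refl

  embAx-sound : ∀ ax → AxiomSound L' ax → AxiomSound combined (embAx ax)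
  embAx-sound ax sound Γ Δ M =
    satisfies-translateSequent⇒satisfies M (axInst (embAx ax) Γ Δ)
      (subst (Satisfies L' M) (sym (translateSequent-embAx ax Γ Δ))
        (sound (map τ⊔ Γ) (map τ⊔ Δ) M))

mainTheorem10 : (L'' L' : Logic) (T : ConstructorTranslation L'' L')
    (G : Gentzen (Logic.Con L') (Logic.Prop L')) →
    AxiomsSound L' (Gentzen.axioms G) →
    AxiomsSound (Combination.combined T)
    (GentzenSystem.axioms (Combination.G⊔ T G))
mainTheorem10 L'' L' T G sound ax ax∈ with ∈-map⁻ (Combination.embAx T) ax∈
... | ax' , ax'∈ , refl = embAx-sound T ax' (sound ax' ax'∈)
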